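{- Let $d,n,m$ be positive integers and let $s\in\{3,4\}$ be such that $F_n^s+F_{n+d}^s=F_m$. Then $n=d=1$ and $m=3$.
   Context: The Fibonacci sequence is defined by $F_0=0$, $F_1=1$ and $F_{n+2}=F_{n+1}+F_n$ for $n\ge 0$. -}

module Defs where

open import Data.Nat using (ℕ; zero; suc; _+_)

fib : ℕ → ℕ
fib zero = 0
fib (suc zero) = 1
fib (suc (suc n)) = fib (suc n) + fib n

module Submission where

-- Write N = n + d. The identities 5 F_k³ = F_{3k} − 3 (−1)^k F_k and
-- 25 F_k⁴ = L_{4k} − 4 (−1)^k L_{2k} + 6 (L the Lucas numbers) show that a solution would put
-- 5 F_m within 3 F_n + 3 F_N of F_{3n} + F_{3N} (s = 3), resp. 25 F_m within
-- 4 L_{2n} + 4 L_{2N} + 12 of L_{4n} + L_{4N} (s = 4). For N ≥ 9 put K = 3N − 7, resp. 4N − 12,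
-- and express everything linearly in F_K and F_{K+1}: whatever m is, and whether n is N − 1,
-- N − 2 or smaller, that distance is at least F_{K+1}, resp. F_{K+2}, which exceeds the error.
-- The finitely many cases N ≤ 8 are checked by computation.

open import Defs
open import Data.Nat.Base as ℕ using (ℕ; zero; suc)
open import Data.Empty using (⊥-elim)
open import Data.List using (_∷_; [])
open import Data.Product using (_×_; _,_; proj₁; proj₂)
open import Data.Sum using (_⊎_; inj₁; inj₂)
open import Relation.Binary.Definitions using (tri<; tri≈; tri>)
open import Relation.Nullary using (Dec; yes; no)
open import Relation.Nullary.Decidable using (_→-dec_; _×-dec_; _⊎-dec_; from-yes)
open import Relation.Binary.PropositionalEquality
  using (_≡_; _≢_; refl; sym; trans; cong; cong₂; subst; subst₂; module ≡-Reasoning)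

module _ where
  open import Data.Nat using (_+_; _*_; _≤_; _≤′_; ≤′-refl; ≤′-step; z≤n)
  open import Data.Nat.Properties using (≤-refl; ≤-trans; ≤⇒≤′; m≤m+n; m≤n+m; +-identityʳ; ≤-reflexive; +-monoʳ-≤)
  open import Data.Nat.Tactic.RingSolver using (solve-∀)

  fib-≤-suc : ∀ k → fib k ≤ fib (suc k)
  fib-≤-suc zero    = z≤n
  fib-≤-suc (suc k) = m≤m+n (fib (suc k)) (fib k)

  fib-mono : ∀ {i j} → i ≤ j → fib i ≤ fib j
  fib-mono i≤j = go (≤⇒≤′ i≤j)
    where
    go : ∀ {i j} → i ≤′ j → fib i ≤ fib j
    go ≤′-refl       = ≤-refl
    go {j = suc j} (≤′-step i≤j) = ≤-trans (go i≤j) (fib-≤-suc j)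

  fib-+ : ∀ i j → fib (suc i + j) ≡ fib i * fib j + fib (suc i) * fib (suc j)
  fib-+ zero          j = sym (+-identityʳ (fib (suc j)))
  fib-+ (suc zero)    j = by-ring (fib j) (fib (suc j))
    where
    by-ring : ∀ x y → y + x ≡ 1 * x + 1 * y
    by-ring = solve-∀
  fib-+ (suc (suc i)) j = begin
    fib (suc (suc i) + j) + fib (suc i + j)
      ≡⟨ cong₂ _+_ (fib-+ (suc i) j) (fib-+ i j) ⟩
    (b * x + c * y) + (a * x + b * y)
      ≡⟨ by-ring a b c x y ⟩
    (b + a) * x + (c + b) * y ∎
    where
    open ≡-Reasoning
    a = fib i
    b = fib (suc i)
    c = fib (suc (suc i))
    x = fib j
    y = fib (suc j)
    by-ring : ∀ a b c x y → (b * x + c * y) + (a * x + b * y) ≡ (b + a) * x + (c + b) * y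
    by-ring = solve-∀

  fib[i]*fib[1+j]≤fib[i+j] : ∀ i j → fib i * fib (suc j) ≤ fib (i + j)
  fib[i]*fib[1+j]≤fib[i+j] zero    j = z≤n
  fib[i]*fib[1+j]≤fib[i+j] (suc i) j = ≤-trans (m≤n+m _ (fib i * fib j)) (≤-reflexive (sym (fib-+ i j)))

  lucas : ℕ → ℕ
  lucas zero    = 2
  lucas (suc j) = fib (suc (suc j)) + fib j

  lucas-+ : ∀ i j → lucas (suc (suc i) + j)
          ≡ (fib i + fib (suc (suc i))) * fib j + (fib (suc i) + fib (suc (suc (suc i)))) * fib (suc j)
  lucas-+ i j = trans (cong₂ _+_ (fib-+ (suc (suc i)) j) (fib-+ i j))
                      (by-ring (fib i) (fib (suc i)) (fib (suc (suc i))) (fib (suc (suc (suc i)))) (fib j) (fib (suc j)))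
    where
    by-ring : ∀ a b c d x y → (c * x + d * y) + (a * x + b * y) ≡ (a + c) * x + (b + d) * y
    by-ring = solve-∀

  lucas≤2*fib : ∀ j → lucas j ≤ 2 * fib (suc j)
  lucas≤2*fib zero    = ≤-refl
  lucas≤2*fib (suc j) = +-monoʳ-≤ (fib (suc (suc j))) (≤-trans (fib-mono (m≤n+m j 2)) (m≤m+n _ 0))

module _ where
  open import Data.Integer using (ℤ; +_; -_; _+_; _-_; _*_; _^_; 1ℤ; -1ℤ)
  open import Data.Integer.Properties using (pos-+; pos-*; +-injective; *-identityˡ)
  open import Data.Integer.Tactic.RingSolver using (solve-∀)
  import Data.Nat.Properties as ℕₚ
  open ≡-Reasoning

  F : ℕ → ℤ
  F k = + fib k

  pos-*-^ : ∀ c m n → + (c ℕ.* m ℕ.^ n) ≡ + c * (+ m) ^ n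
  pos-*-^ c m n = trans (pos-* c (m ℕ.^ n)) (cong (+ c *_) (pos-^ n))
    where
    pos-^ : ∀ n → + (m ℕ.^ n) ≡ (+ m) ^ n
    pos-^ zero    = refl
    pos-^ (suc n) = trans (pos-* m (m ℕ.^ n)) (cong (+ m *_) (pos-^ n))

  F-suc-suc : ∀ k → F (suc (suc k)) ≡ F (suc k) + F k
  F-suc-suc k = pos-+ (fib (suc k)) (fib k)

  F-+ : ∀ i j → F (i ℕ.+ j) ≡ F i * F (suc j) + (F (suc i) - F i) * F j
  F-+ zero    j = by-ring (F (suc j)) (F j)
    where
    by-ring : ∀ y x → x ≡ + 0 * y + (+ 1 - + 0) * x
    by-ring = solve-∀
  F-+ (suc i) j = begin
    F (suc i ℕ.+ j)
      ≡⟨ cong +_ (fib-+ i j) ⟩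
    + (fib i ℕ.* fib j ℕ.+ fib (suc i) ℕ.* fib (suc j))
      ≡⟨ trans (pos-+ (fib i ℕ.* fib j) _) (cong₂ _+_ (pos-* (fib i) (fib j)) (pos-* (fib (suc i)) (fib (suc j)))) ⟩
    F i * F j + F (suc i) * F (suc j)
      ≡⟨ by-ring (F i) (F (suc i)) (F j) (F (suc j)) ⟩
    F (suc i) * F (suc j) + ((F (suc i) + F i) - F (suc i)) * F j
      ≡⟨ cong (λ z → F (suc i) * F (suc j) + (z - F (suc i)) * F j) (F-suc-suc i) ⟨
    F (suc i) * F (suc j) + (F (suc (suc i)) - F (suc i)) * F j ∎
    where
    by-ring : ∀ a b x y → a * x + b * y ≡ b * y + ((b + a) - b) * x
    by-ring = solve-∀

  F-double : ∀ k → F (k ℕ.+ k) ≡ F k * (+ 2 * F (suc k) - F k)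
  F-double k = trans (F-+ k k) (by-ring (F k) (F (suc k)))
    where
    by-ring : ∀ x y → x * y + (y - x) * x ≡ x * (+ 2 * y - x)
    by-ring = solve-∀

  F-double-suc : ∀ k → F (suc (k ℕ.+ k)) ≡ F k * F k + F (suc k) * F (suc k)
  F-double-suc k = begin
    F (suc k ℕ.+ k)                      ≡⟨ F-+ (suc k) k ⟩
    y * y + (F (suc (suc k)) - y) * x    ≡⟨ cong (λ z → y * y + (z - y) * x) (F-suc-suc k) ⟩
    y * y + ((y + x) - y) * x            ≡⟨ by-ring x y ⟩
    x * x + y * y                        ∎
    where
    x = F k
    y = F (suc k)
    by-ring : ∀ x y → y * y + ((y + x) - y) * x ≡ x * x + y * y
    by-ring = solve-∀

  -- cassini k is (−1)^k, but kept as a polynomial in F k and F (suc k) so that F-triple and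
  -- F-quartic below are pure polynomial identities.
  cassini : ℕ → ℤ
  cassini k = F (suc k) * F (suc k) - F (suc k) * F k - F k * F k

  cassini-suc : ∀ k → cassini (suc k) ≡ - cassini k
  cassini-suc k = trans (cong (λ z → z * z - z * F (suc k) - F (suc k) * F (suc k)) (F-suc-suc k))
                        (by-ring (F k) (F (suc k)))
    where
    by-ring : ∀ x y → (y + x) * (y + x) - (y + x) * y - y * y ≡ - (y * y - y * x - x * x)
    by-ring = solve-∀

  cassini-±1 : ∀ k → cassini k ≡ 1ℤ ⊎ cassini k ≡ -1ℤ
  cassini-±1 zero = inj₁ refl
  cassini-±1 (suc k) with cassini-±1 k
  ... | inj₁ σ≡1  = inj₂ (trans (cassini-suc k) (cong -_ σ≡1))
  ... | inj₂ σ≡-1 = inj₁ (trans (cassini-suc k) (cong -_ σ≡-1))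

  F-triple : ∀ k → + (5 ℕ.* fib k ℕ.^ 3) + cassini k * + (3 ℕ.* fib k) ≡ F (k ℕ.+ k ℕ.+ k)
  F-triple k = begin
    + (5 ℕ.* fib k ℕ.^ 3) + cassini k * + (3 ℕ.* fib k)
      ≡⟨ cong₂ (λ a b → a + cassini k * b) (pos-*-^ 5 (fib k) 3) (pos-* 3 (fib k)) ⟩
    + 5 * x ^ 3 + cassini k * (+ 3 * x)
      ≡⟨ by-ring x y ⟩
    x * (+ 2 * y - x) * y + ((x * x + y * y) - x * (+ 2 * y - x)) * x
      ≡⟨ cong₂ (λ u v → u * y + (v - u) * x) (F-double k) (F-double-suc k) ⟨
    F (k ℕ.+ k) * y + (F (suc (k ℕ.+ k)) - F (k ℕ.+ k)) * x
      ≡⟨ F-+ (k ℕ.+ k) k ⟨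
    F (k ℕ.+ k ℕ.+ k) ∎
    where
    x = F k
    y = F (suc k)
    -- x ^ 3 unfolded: the ring solver does not accept ℤ's _^_.
    by-ring : ∀ x y → + 5 * (x * (x * (x * 1ℤ))) + (y * y - y * x - x * x) * (+ 3 * x)
                  ≡ x * (+ 2 * y - x) * y + ((x * x + y * y) - x * (+ 2 * y - x)) * x
    by-ring = solve-∀

  lucas-ℤ : ∀ j → + lucas j ≡ + 2 * F (suc j) - F j
  lucas-ℤ zero    = refl
  lucas-ℤ (suc j) = begin
    + (fib (suc (suc j)) ℕ.+ fib j)          ≡⟨ pos-+ (fib (suc (suc j))) (fib j) ⟩
    F (suc (suc j)) + F j                    ≡⟨ cong (_+ F j) (F-suc-suc j) ⟩
    (F (suc j) + F j) + F j                  ≡⟨ by-ring (F j) (F (suc j)) ⟩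
    + 2 * (F (suc j) + F j) - F (suc j)      ≡⟨ cong (λ z → + 2 * z - F (suc j)) (F-suc-suc j) ⟨
    + 2 * F (suc (suc j)) - F (suc j)        ∎
    where
    by-ring : ∀ x y → (y + x) + x ≡ + 2 * (y + x) - y
    by-ring = solve-∀

  lucas-double : ∀ j → + lucas (j ℕ.+ j)
               ≡ + 2 * (F j * F j + F (suc j) * F (suc j)) - F j * (+ 2 * F (suc j) - F j)
  lucas-double j = trans (lucas-ℤ (j ℕ.+ j)) (cong₂ (λ v u → + 2 * v - u) (F-double-suc j) (F-double j))

  ±1-square : ∀ {σ} → σ ≡ 1ℤ ⊎ σ ≡ -1ℤ → σ * σ ≡ 1ℤ
  ±1-square (inj₁ refl) = refl
  ±1-square (inj₂ refl) = refl

  F-quartic : ∀ k → + (25 ℕ.* fib k ℕ.^ 4) + cassini k * + (4 ℕ.* lucas (k ℕ.+ k))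
                  ≡ + (lucas ((k ℕ.+ k) ℕ.+ (k ℕ.+ k)) ℕ.+ 6)
  F-quartic k = begin
    + (25 ℕ.* fib k ℕ.^ 4) + cassini k * + (4 ℕ.* lucas (k ℕ.+ k))
      ≡⟨ cong₂ (λ a b → a + cassini k * b) (pos-*-^ 25 (fib k) 4)
               (trans (pos-* 4 (lucas (k ℕ.+ k))) (cong (+ 4 *_) (lucas-double k))) ⟩
    + 25 * x ^ 4 + cassini k * (+ 4 * ℓ x y)
      ≡⟨ by-ring x y ⟩
    ℓ (x * (+ 2 * y - x)) (x * x + y * y) + + 6 * (cassini k * cassini k)
      ≡⟨ cong₂ (λ u v → ℓ u v + + 6 * (cassini k * cassini k)) (F-double k) (F-double-suc k) ⟨
    ℓ (F (k ℕ.+ k)) (F (suc (k ℕ.+ k))) + + 6 * (cassini k * cassini k)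
      ≡⟨ cong₂ _+_ (lucas-double (k ℕ.+ k)) (cong (+ 6 *_) (sym (±1-square (cassini-±1 k)))) ⟨
    + lucas ((k ℕ.+ k) ℕ.+ (k ℕ.+ k)) + + 6
      ≡⟨ pos-+ (lucas ((k ℕ.+ k) ℕ.+ (k ℕ.+ k))) 6 ⟨
    + (lucas ((k ℕ.+ k) ℕ.+ (k ℕ.+ k)) ℕ.+ 6) ∎
    where
    x = F k
    y = F (suc k)
    ℓ : ℤ → ℤ → ℤ
    ℓ u v = + 2 * (u * u + v * v) - u * (+ 2 * v - u)
    by-ring : ∀ x y →
      + 25 * (x * (x * (x * (x * 1ℤ))))
        + (y * y - y * x - x * x) * (+ 4 * (+ 2 * (x * x + y * y) - x * (+ 2 * y - x)))
      ≡ + 2 * (x * (+ 2 * y - x) * (x * (+ 2 * y - x)) + (x * x + y * y) * (x * x + y * y))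
        - x * (+ 2 * y - x) * (+ 2 * (x * x + y * y) - x * (+ 2 * y - x))
        + + 6 * ((y * y - y * x - x * x) * (y * y - y * x - x * x))
    by-ring = solve-∀

  ∣-∣-signed : ∀ {a b e σ} → σ ≡ 1ℤ ⊎ σ ≡ -1ℤ → + a + σ * + e ≡ + b → ℕ.∣ a - b ∣ ≡ e
  ∣-∣-signed {a} {b} {e} (inj₁ refl) eq =
    trans (cong (ℕ.∣ a -_∣) b≡a+e) (ℕₚ.∣m-m+n∣≡n a e)
    where
    b≡a+e : b ≡ a ℕ.+ e
    b≡a+e = +-injective (trans (sym eq) (trans (cong (λ z → + a + z) (*-identityˡ (+ e))) (sym (pos-+ a e))))
  ∣-∣-signed {a} {b} {e} (inj₂ refl) eq =
    trans (cong (ℕ.∣_- b ∣) a≡b+e) (trans (ℕₚ.∣-∣-comm (b ℕ.+ e) b) (ℕₚ.∣m-m+n∣≡n b e))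
    where
    by-ring : ∀ a e → (a + -1ℤ * e) + e ≡ a
    by-ring = solve-∀
    a≡b+e : a ≡ b ℕ.+ e
    a≡b+e = +-injective (trans (sym (by-ring (+ a) (+ e))) (trans (cong (_+ + e) eq) (sym (pos-+ b e))))

open import Data.Nat using (_+_; _*_; _^_; _≤_; _<_; _≤?_; _<?_; ∣_-_∣; z≤n; s≤s)
open import Data.Nat.Properties
open import Data.Nat.Tactic.RingSolver using (solve-∀; solve)
open ≤-Reasoning

m+n≤o⇒n≤∣m-o∣ : ∀ {m n o} → m + n ≤ o → n ≤ ∣ m - o ∣
m+n≤o⇒n≤∣m-o∣ {m} {n} {o} m+n≤o = +-cancelˡ-≤ m n ∣ m - o ∣ (≤-trans m+n≤o (m≤n+∣n-m∣ o m))

o+n≤m⇒n≤∣m-o∣ : ∀ {m n o} → o + n ≤ m → n ≤ ∣ m - o ∣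
o+n≤m⇒n≤∣m-o∣ {m} {n} {o} o+n≤m = subst (n ≤_) (∣-∣-comm o m) (m+n≤o⇒n≤∣m-o∣ o+n≤m)

∣m+n-o+p∣≤∣m-o∣+∣n-p∣ : ∀ m n o p → ∣ m + n - (o + p) ∣ ≤ ∣ m - o ∣ + ∣ n - p ∣
∣m+n-o+p∣≤∣m-o∣+∣n-p∣ m n o p = begin
  ∣ m + n - (o + p) ∣                      ≤⟨ ∣-∣-triangle (m + n) (o + n) (o + p) ⟩
  ∣ m + n - (o + n) ∣ + ∣ o + n - (o + p) ∣ ≡⟨ cong₂ _+_ first (∣m+n-m+o∣≡∣n-o∣ o n p) ⟩
  ∣ m - o ∣ + ∣ n - p ∣                    ∎
  where
  first : ∣ m + n - (o + n) ∣ ≡ ∣ m - o ∣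
  first = trans (cong₂ ∣_-_∣ (+-comm m n) (+-comm o n)) (∣m+n-m+o∣≡∣n-o∣ n m o)

∣m-n∣≤∣m-n+o∣+o : ∀ m n o → ∣ m - n ∣ ≤ ∣ m - (n + o) ∣ + o
∣m-n∣≤∣m-n+o∣+o m n o = begin
  ∣ m - n ∣                          ≤⟨ ∣-∣-triangle m (n + o) n ⟩
  ∣ m - (n + o) ∣ + ∣ n + o - n ∣    ≡⟨ cong (∣ m - (n + o) ∣ +_) (trans (∣-∣-comm (n + o) n) (∣m-m+n∣≡n n o)) ⟩
  ∣ m - (n + o) ∣ + o                ∎

cube-near : ∀ k → ∣ 5 * fib k ^ 3 - fib (k + k + k) ∣ ≡ 3 * fib k
cube-near k = ∣-∣-signed (cassini-±1 k) (F-triple k)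

quartic-near : ∀ k → ∣ 25 * fib k ^ 4 - lucas ((k + k) + (k + k)) ∣ ≤ 4 * lucas (k + k) + 6
quartic-near k = begin
  ∣ 25 * fib k ^ 4 - L ∣            ≤⟨ ∣m-n∣≤∣m-n+o∣+o (25 * fib k ^ 4) L 6 ⟩
  ∣ 25 * fib k ^ 4 - (L + 6) ∣ + 6  ≡⟨ cong (_+ 6) (∣-∣-signed (cassini-±1 k) (F-quartic k)) ⟩
  4 * lucas (k + k) + 6             ∎
  where
  L = lucas ((k + k) + (k + k))

cube-sum-near : ∀ a b {f} → fib a ^ 3 + fib b ^ 3 ≡ f →
  ∣ 5 * f - (fib (a + a + a) + fib (b + b + b)) ∣ ≤ 3 * fib a + 3 * fib b
cube-sum-near a b refl = begin
  ∣ 5 * (fib a ^ 3 + fib b ^ 3) - (P + Q) ∣     ≡⟨ cong (∣_- P + Q ∣) (*-distribˡ-+ 5 (fib a ^ 3) (fib b ^ 3)) ⟩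
  ∣ 5 * fib a ^ 3 + 5 * fib b ^ 3 - (P + Q) ∣   ≤⟨ ∣m+n-o+p∣≤∣m-o∣+∣n-p∣ (5 * fib a ^ 3) (5 * fib b ^ 3) P Q ⟩
  ∣ 5 * fib a ^ 3 - P ∣ + ∣ 5 * fib b ^ 3 - Q ∣ ≡⟨ cong₂ _+_ (cube-near a) (cube-near b) ⟩
  3 * fib a + 3 * fib b                          ∎
  where
  P = fib (a + a + a)
  Q = fib (b + b + b)

quartic-sum-near : ∀ a b {f} → fib a ^ 4 + fib b ^ 4 ≡ f →
  ∣ 25 * f - (lucas ((a + a) + (a + a)) + lucas ((b + b) + (b + b))) ∣
    ≤ (4 * lucas (a + a) + 6) + (4 * lucas (b + b) + 6)
quartic-sum-near a b refl = begin
  ∣ 25 * (fib a ^ 4 + fib b ^ 4) - (P + Q) ∣      ≡⟨ cong (∣_- P + Q ∣) (*-distribˡ-+ 25 (fib a ^ 4) (fib b ^ 4)) ⟩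
  ∣ 25 * fib a ^ 4 + 25 * fib b ^ 4 - (P + Q) ∣   ≤⟨ ∣m+n-o+p∣≤∣m-o∣+∣n-p∣ (25 * fib a ^ 4) (25 * fib b ^ 4) P Q ⟩
  ∣ 25 * fib a ^ 4 - P ∣ + ∣ 25 * fib b ^ 4 - Q ∣ ≤⟨ +-mono-≤ (quartic-near a) (quartic-near b) ⟩
  (4 * lucas (a + a) + 6) + (4 * lucas (b + b) + 6) ∎
  where
  P = lucas ((a + a) + (a + a))
  Q = lucas ((b + b) + (b + b))

fib-trichotomy : ∀ m j → fib m ≤ fib j ⊎ fib m ≡ fib (suc j) ⊎ fib (suc (suc j)) ≤ fib m
fib-trichotomy m j with <-cmp m (suc j)
... | tri< m<1+j _ _ = inj₁ (fib-mono (≤-pred m<1+j))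
... | tri≈ _ m≡1+j _ = inj₂ (inj₁ (cong fib m≡1+j))
... | tri> _ _ 1+j<m = inj₂ (inj₂ (fib-mono 1+j<m))

cube-gap-linear : ∀ {x y f A} →
  f ≤ x + 2 * y ⊎ f ≡ 2 * x + 3 * y ⊎ 3 * x + 5 * y ≤ f →
  A ≡ 2 * x + 3 * y ⊎ A ≤ y →
  y ≤ ∣ 5 * f - (A + (8 * x + 13 * y)) ∣
cube-gap-linear {x} {y} {f} {A} (inj₁ f≤) _ = m+n≤o⇒n≤∣m-o∣ (begin
  5 * f + y                 ≤⟨ +-monoˡ-≤ y (*-monoʳ-≤ 5 f≤) ⟩
  5 * (x + 2 * y) + y       ≤⟨ m≤m+n _ (3 * x + 2 * y + A) ⟩
  5 * (x + 2 * y) + y + (3 * x + 2 * y + A) ≡⟨ solve (x ∷ y ∷ A ∷ []) ⟩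
  A + (8 * x + 13 * y)      ∎)
cube-gap-linear {x} {y} (inj₂ (inj₁ refl)) (inj₁ refl) =
  m+n≤o⇒n≤∣m-o∣ {5 * (2 * x + 3 * y)} (≤-reflexive (solve (x ∷ y ∷ [])))
cube-gap-linear {x} {y} {A = A} (inj₂ (inj₁ refl)) (inj₂ A≤y) = o+n≤m⇒n≤∣m-o∣ (begin
  A + (8 * x + 13 * y) + y  ≤⟨ +-monoˡ-≤ y (+-monoˡ-≤ (8 * x + 13 * y) A≤y) ⟩
  y + (8 * x + 13 * y) + y  ≤⟨ m≤m+n _ (2 * x) ⟩
  y + (8 * x + 13 * y) + y + 2 * x ≡⟨ solve (x ∷ y ∷ []) ⟩
  5 * (2 * x + 3 * y)       ∎)
cube-gap-linear {x} {y} {f} {A} (inj₂ (inj₂ ≤f)) A-cases = o+n≤m⇒n≤∣m-o∣ (begin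
  A + (8 * x + 13 * y) + y  ≤⟨ +-monoˡ-≤ y (+-monoˡ-≤ (8 * x + 13 * y) (A≤ A-cases)) ⟩
  (2 * x + 3 * y) + (8 * x + 13 * y) + y ≤⟨ m≤m+n _ (5 * x + 8 * y) ⟩
  (2 * x + 3 * y) + (8 * x + 13 * y) + y + (5 * x + 8 * y) ≡⟨ solve (x ∷ y ∷ []) ⟩
  5 * (3 * x + 5 * y)       ≤⟨ *-monoʳ-≤ 5 ≤f ⟩
  5 * f                     ∎)
  where
  A≤ : A ≡ 2 * x + 3 * y ⊎ A ≤ y → A ≤ 2 * x + 3 * y
  A≤ (inj₁ refl) = ≤-refl
  A≤ (inj₂ A≤y)  = ≤-trans A≤y (≤-trans (m≤n+m y (2 * x + 2 * y)) (≤-reflexive (solve (x ∷ y ∷ []))))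

quartic-gap-linear : ∀ {x y f A} →
  f ≤ 5 * x + 8 * y ⊎ f ≡ 8 * x + 13 * y ⊎ 13 * x + 21 * y ≤ f →
  A ≡ 29 * x + 47 * y ⊎ A ≡ 4 * x + 7 * y ⊎ A ≤ 2 * y →
  y + x ≤ ∣ 25 * f - (A + (199 * x + 322 * y)) ∣
quartic-gap-linear {x} {y} {f} {A} (inj₁ f≤) _ = m+n≤o⇒n≤∣m-o∣ {25 * f} (begin
  25 * f + (y + x)            ≤⟨ +-monoˡ-≤ (y + x) (*-monoʳ-≤ 25 f≤) ⟩
  25 * (5 * x + 8 * y) + (y + x) ≤⟨ m≤m+n _ (73 * x + 121 * y + A) ⟩
  25 * (5 * x + 8 * y) + (y + x) + (73 * x + 121 * y + A) ≡⟨ solve (x ∷ y ∷ A ∷ []) ⟩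
  A + (199 * x + 322 * y)     ∎)
quartic-gap-linear {x} {y} (inj₂ (inj₁ refl)) (inj₁ refl) =
  m+n≤o⇒n≤∣m-o∣ {25 * (8 * x + 13 * y)} (begin
    25 * (8 * x + 13 * y) + (y + x) ≤⟨ m≤m+n _ (27 * x + 43 * y) ⟩
    25 * (8 * x + 13 * y) + (y + x) + (27 * x + 43 * y) ≡⟨ solve (x ∷ y ∷ []) ⟩
    (29 * x + 47 * y) + (199 * x + 322 * y) ∎)
quartic-gap-linear {x} {y} (inj₂ (inj₁ refl)) (inj₂ (inj₁ refl)) =
  m+n≤o⇒n≤∣m-o∣ {25 * (8 * x + 13 * y)} (begin
    25 * (8 * x + 13 * y) + (y + x) ≤⟨ m≤m+n _ (2 * x + 3 * y) ⟩
    25 * (8 * x + 13 * y) + (y + x) + (2 * x + 3 * y) ≡⟨ solve (x ∷ y ∷ []) ⟩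
    (4 * x + 7 * y) + (199 * x + 322 * y) ∎)
quartic-gap-linear {x} {y} {A = A} (inj₂ (inj₁ refl)) (inj₂ (inj₂ A≤2y)) = o+n≤m⇒n≤∣m-o∣ (begin
  A + (199 * x + 322 * y) + (y + x)     ≤⟨ +-monoˡ-≤ (y + x) (+-monoˡ-≤ (199 * x + 322 * y) A≤2y) ⟩
  2 * y + (199 * x + 322 * y) + (y + x) ≡⟨ solve (x ∷ y ∷ []) ⟩
  25 * (8 * x + 13 * y)                 ∎)
quartic-gap-linear {x} {y} {f} {A} (inj₂ (inj₂ ≤f)) A-cases = o+n≤m⇒n≤∣m-o∣ (begin
  A + (199 * x + 322 * y) + (y + x) ≤⟨ +-monoˡ-≤ (y + x) (+-monoˡ-≤ (199 * x + 322 * y) (A≤ A-cases)) ⟩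
  (29 * x + 47 * y) + (199 * x + 322 * y) + (y + x) ≤⟨ m≤m+n _ (96 * x + 155 * y) ⟩
  (29 * x + 47 * y) + (199 * x + 322 * y) + (y + x) + (96 * x + 155 * y) ≡⟨ solve (x ∷ y ∷ []) ⟩
  25 * (13 * x + 21 * y)            ≤⟨ *-monoʳ-≤ 25 ≤f ⟩
  25 * f                            ∎)
  where
  A≤ : A ≡ 29 * x + 47 * y ⊎ A ≡ 4 * x + 7 * y ⊎ A ≤ 2 * y → A ≤ 29 * x + 47 * y
  A≤ (inj₁ refl)        = ≤-refl
  A≤ (inj₂ (inj₁ refl)) = ≤-trans (m≤m+n (4 * x + 7 * y) (25 * x + 40 * y)) (≤-reflexive (solve (x ∷ y ∷ [])))
  A≤ (inj₂ (inj₂ A≤2y)) = ≤-trans A≤2y (≤-trans (m≤m+n (2 * y) (29 * x + 45 * y)) (≤-reflexive (solve (x ∷ y ∷ []))))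

cube-gap : ∀ K m {A} → A ≡ fib (4 + K) ⊎ A ≤ fib (suc K) →
  fib (suc K) ≤ ∣ 5 * fib m - (A + fib (7 + K)) ∣
cube-gap K m {A} A-cases =
  subst (λ z → y ≤ ∣ 5 * fib m - (A + z) ∣) (sym (fib-+ 6 K)) (cube-gap-linear {x} {y} fib-m-cases (A-linear A-cases))
  where
  x = fib K
  y = fib (suc K)
  fib-m-cases : fib m ≤ x + 2 * y ⊎ fib m ≡ 2 * x + 3 * y ⊎ 3 * x + 5 * y ≤ fib m
  fib-m-cases with fib-trichotomy m (3 + K)
  ... | inj₁ below        = inj₁ (≤-trans below (≤-reflexive (trans (fib-+ 2 K) (cong (_+ 2 * y) (*-identityˡ x)))))
  ... | inj₂ (inj₁ equal) = inj₂ (inj₁ (trans equal (fib-+ 3 K)))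
  ... | inj₂ (inj₂ above) = inj₂ (inj₂ (≤-trans (≤-reflexive (sym (fib-+ 4 K))) above))
  A-linear : A ≡ fib (4 + K) ⊎ A ≤ y → A ≡ 2 * x + 3 * y ⊎ A ≤ y
  A-linear (inj₁ A≡) = inj₁ (trans A≡ (fib-+ 3 K))
  A-linear (inj₂ A≤) = inj₂ A≤

quartic-gap : ∀ K m {A} → A ≡ lucas (8 + K) ⊎ A ≡ lucas (4 + K) ⊎ A ≤ 2 * fib (suc K) →
  fib (2 + K) ≤ ∣ 25 * fib m - (A + lucas (12 + K)) ∣
quartic-gap K m {A} A-cases =
  subst (λ z → y + x ≤ ∣ 25 * fib m - (A + z) ∣) (sym (lucas-+ 10 K)) (quartic-gap-linear {x} {y} fib-m-cases (A-linear A-cases))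
  where
  x = fib K
  y = fib (suc K)
  fib-m-cases : fib m ≤ 5 * x + 8 * y ⊎ fib m ≡ 8 * x + 13 * y ⊎ 13 * x + 21 * y ≤ fib m
  fib-m-cases with fib-trichotomy m (6 + K)
  ... | inj₁ below        = inj₁ (≤-trans below (≤-reflexive (fib-+ 5 K)))
  ... | inj₂ (inj₁ equal) = inj₂ (inj₁ (trans equal (fib-+ 6 K)))
  ... | inj₂ (inj₂ above) = inj₂ (inj₂ (≤-trans (≤-reflexive (sym (fib-+ 7 K))) above))
  A-linear : A ≡ lucas (8 + K) ⊎ A ≡ lucas (4 + K) ⊎ A ≤ 2 * y →
             A ≡ 29 * x + 47 * y ⊎ A ≡ 4 * x + 7 * y ⊎ A ≤ 2 * y
  A-linear (inj₁ A≡)        = inj₁ (trans A≡ (lucas-+ 6 K))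
  A-linear (inj₂ (inj₁ A≡)) = inj₂ (inj₁ (trans A≡ (lucas-+ 2 K)))
  A-linear (inj₂ (inj₂ A≤)) = inj₂ (inj₂ A≤)

summand-cases : ∀ {n d k} → 1 ≤ d → n + d ≡ 3 + k → n ≡ 2 + k ⊎ n ≡ 1 + k ⊎ n ≤ k
summand-cases {n} {suc zero}          _ e = inj₁ (suc-injective (trans (+-comm 1 n) e))
summand-cases {n} {suc (suc zero)} {k} _ e = inj₂ (inj₁ (+-cancelˡ-≡ 2 n (1 + k) (trans (+-comm 2 n) e)))
summand-cases {n} {suc (suc (suc d))} {k} _ e =
  inj₂ (inj₂ (≤-trans (m≤n+m n d) (≤-reflexive (+-cancelˡ-≡ 3 (d + n) k (trans (+-comm (3 + d) n) e)))))

cube-error : ∀ {n t} → n ≤ 9 + t → 3 * fib n + 3 * fib (9 + t) < fib (21 + 3 * t)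
cube-error {n} {t} n≤N = begin-strict
  3 * fib n + 3 * b          ≤⟨ +-monoˡ-≤ (3 * b) (*-monoʳ-≤ 3 (fib-mono n≤N)) ⟩
  3 * b + 3 * b              ≡⟨ *-distribʳ-+ b 3 3 ⟨
  6 * b                      <⟨ m<n+m (6 * b) (fib-mono {1} {9 + t} (s≤s z≤n)) ⟩
  7 * b                      ≤⟨ *-monoˡ-≤ b (≤-trans (n≤1+n 7) (fib-mono (m≤m+n 6 (7 + 2 * t)))) ⟩
  fib (13 + 2 * t) * b       ≤⟨ fib[i]*fib[1+j]≤fib[i+j] (13 + 2 * t) (8 + t) ⟩
  fib (13 + 2 * t + (8 + t)) ≡⟨ cong fib (index t) ⟩
  fib (21 + 3 * t)           ∎
  where
  b = fib (9 + t)
  index : ∀ t → 13 + 2 * t + (8 + t) ≡ 21 + 3 * t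
  index = solve-∀

quartic-error : ∀ {n t} → n ≤ 9 + t →
  (4 * lucas (n + n) + 6) + (4 * lucas ((9 + t) + (9 + t)) + 6) < fib (26 + 4 * t)
quartic-error {n} {t} n≤N = begin-strict
  (4 * lucas (n + n) + 6) + (4 * lucas (N + N) + 6)
    ≤⟨ +-mono-≤ (+-monoˡ-≤ 6 (*-monoʳ-≤ 4 (≤-trans (lucas≤2*fib (n + n)) (*-monoʳ-≤ 2 (fib-mono (s≤s (+-mono-≤ n≤N n≤N)))))))
                (+-monoˡ-≤ 6 (*-monoʳ-≤ 4 (lucas≤2*fib (N + N)))) ⟩
  (4 * (2 * f) + 6) + (4 * (2 * f) + 6) ≡⟨ by-ring f ⟩
  16 * f + 12                <⟨ +-monoʳ-< (16 * f) (≤-trans (m≤m+n 13 2) (*-monoʳ-≤ 5 (fib-mono {4} {suc (N + N)} (s≤s (s≤s (s≤s (s≤s z≤n))))))) ⟩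
  16 * f + 5 * f             ≡⟨ *-distribʳ-+ f 16 5 ⟨
  21 * f                     ≤⟨ *-monoˡ-≤ f (fib-mono {8} (m≤m+n 8 (2 * t))) ⟩
  fib (8 + 2 * t) * f        ≤⟨ fib[i]*fib[1+j]≤fib[i+j] (8 + 2 * t) (N + N) ⟩
  fib (8 + 2 * t + (N + N))  ≡⟨ cong fib (index t) ⟩
  fib (26 + 4 * t)           ∎
  where
  N = 9 + t
  f = fib (suc (N + N))
  by-ring : ∀ f → (4 * (2 * f) + 6) + (4 * (2 * f) + 6) ≡ 16 * f + 12
  by-ring = solve-∀
  index : ∀ t → 8 + 2 * t + ((9 + t) + (9 + t)) ≡ 26 + 4 * t
  index = solve-∀

no-large-cube-solution : ∀ {n d m t} → 1 ≤ d → n + d ≡ 9 + t → fib n ^ 3 + fib (n + d) ^ 3 ≢ fib m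
no-large-cube-solution {n} {d} {m} {t} 1≤d n+d≡N eq = <⇒≱ (cube-error n≤N) (begin
  fib (suc K)
    ≤⟨ cube-gap K m (A-cases (summand-cases 1≤d n+d≡N)) ⟩
  ∣ 5 * fib m - (fib (n + n + n) + fib (7 + K)) ∣
    ≡⟨ cong (λ i → ∣ 5 * fib m - (fib (n + n + n) + fib i) ∣) (3N≡7+K t) ⟨
  ∣ 5 * fib m - (fib (n + n + n) + fib (N + N + N)) ∣
    ≤⟨ cube-sum-near n N (subst (λ z → fib n ^ 3 + fib z ^ 3 ≡ fib m) n+d≡N eq) ⟩
  3 * fib n + 3 * fib N ∎)
  where
  N = 9 + t
  K = 20 + 3 * t
  n≤N : n ≤ N
  n≤N = ≤-trans (m≤m+n n d) (≤-reflexive n+d≡N)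
  3N≡7+K : ∀ t → (9 + t) + (9 + t) + (9 + t) ≡ 7 + (20 + 3 * t)
  3N≡7+K = solve-∀
  3[8+t]≡4+K : ∀ t → (8 + t) + (8 + t) + (8 + t) ≡ 4 + (20 + 3 * t)
  3[8+t]≡4+K = solve-∀
  3[7+t]≡1+K : ∀ t → (7 + t) + (7 + t) + (7 + t) ≡ 1 + (20 + 3 * t)
  3[7+t]≡1+K = solve-∀
  3[6+t]≡K-2 : ∀ t → (6 + t) + (6 + t) + (6 + t) ≡ 18 + 3 * t
  3[6+t]≡K-2 = solve-∀
  A-cases : n ≡ 8 + t ⊎ n ≡ 7 + t ⊎ n ≤ 6 + t → fib (n + n + n) ≡ fib (4 + K) ⊎ fib (n + n + n) ≤ fib (suc K)
  A-cases (inj₁ n≡)        = inj₁ (cong fib (trans (cong (λ z → z + z + z) n≡) (3[8+t]≡4+K t)))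
  A-cases (inj₂ (inj₁ n≡)) = inj₂ (≤-reflexive (cong fib (trans (cong (λ z → z + z + z) n≡) (3[7+t]≡1+K t))))
  A-cases (inj₂ (inj₂ n≤)) = inj₂ (fib-mono (begin
    n + n + n                   ≤⟨ +-mono-≤ (+-mono-≤ n≤ n≤) n≤ ⟩
    (6 + t) + (6 + t) + (6 + t) ≡⟨ 3[6+t]≡K-2 t ⟩
    18 + 3 * t                  ≤⟨ m≤n+m _ 3 ⟩
    suc K                       ∎))

no-large-quartic-solution : ∀ {n d m t} → 1 ≤ d → n + d ≡ 9 + t → fib n ^ 4 + fib (n + d) ^ 4 ≢ fib m
no-large-quartic-solution {n} {d} {m} {t} 1≤d n+d≡N eq = <⇒≱ (quartic-error n≤N) (begin
  fib (2 + K)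
    ≤⟨ quartic-gap K m (A-cases (summand-cases 1≤d n+d≡N)) ⟩
  ∣ 25 * fib m - (lucas 4n + lucas (12 + K)) ∣
    ≡⟨ cong (λ i → ∣ 25 * fib m - (lucas 4n + lucas i) ∣) (4N≡12+K t) ⟨
  ∣ 25 * fib m - (lucas 4n + lucas ((N + N) + (N + N))) ∣
    ≤⟨ quartic-sum-near n N (subst (λ z → fib n ^ 4 + fib z ^ 4 ≡ fib m) n+d≡N eq) ⟩
  (4 * lucas (n + n) + 6) + (4 * lucas (N + N) + 6) ∎)
  where
  N = 9 + t
  K = 24 + 4 * t
  4n = (n + n) + (n + n)
  n≤N : n ≤ N
  n≤N = ≤-trans (m≤m+n n d) (≤-reflexive n+d≡N)
  4N≡12+K : ∀ t → ((9 + t) + (9 + t)) + ((9 + t) + (9 + t)) ≡ 12 + (24 + 4 * t)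
  4N≡12+K = solve-∀
  4[8+t]≡8+K : ∀ t → ((8 + t) + (8 + t)) + ((8 + t) + (8 + t)) ≡ 8 + (24 + 4 * t)
  4[8+t]≡8+K = solve-∀
  4[7+t]≡4+K : ∀ t → ((7 + t) + (7 + t)) + ((7 + t) + (7 + t)) ≡ 4 + (24 + 4 * t)
  4[7+t]≡4+K = solve-∀
  4[6+t]≡K : ∀ t → ((6 + t) + (6 + t)) + ((6 + t) + (6 + t)) ≡ 24 + 4 * t
  4[6+t]≡K = solve-∀
  A-cases : n ≡ 8 + t ⊎ n ≡ 7 + t ⊎ n ≤ 6 + t →
            lucas 4n ≡ lucas (8 + K) ⊎ lucas 4n ≡ lucas (4 + K) ⊎ lucas 4n ≤ 2 * fib (suc K)
  A-cases (inj₁ n≡)        = inj₁ (cong lucas (trans (cong (λ z → (z + z) + (z + z)) n≡) (4[8+t]≡8+K t)))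
  A-cases (inj₂ (inj₁ n≡)) = inj₂ (inj₁ (cong lucas (trans (cong (λ z → (z + z) + (z + z)) n≡) (4[7+t]≡4+K t))))
  A-cases (inj₂ (inj₂ n≤)) = inj₂ (inj₂ (≤-trans (lucas≤2*fib 4n) (*-monoʳ-≤ 2 (fib-mono (s≤s (begin
    4n                                        ≤⟨ +-mono-≤ (+-mono-≤ n≤ n≤) (+-mono-≤ n≤ n≤) ⟩
    ((6 + t) + (6 + t)) + ((6 + t) + (6 + t)) ≡⟨ 4[6+t]≡K t ⟩
    K                                         ∎))))))

-- Evaluating fib directly is exponential, so the finite check uses the iterative fib-iter.
fib-step : ℕ × ℕ → ℕ × ℕ
fib-step (a , b) = b , b + a

fib-pair : ℕ → ℕ × ℕ
fib-pair zero    = 0 , 1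
fib-pair (suc k) = fib-step (fib-pair k)

fib-iter : ℕ → ℕ
fib-iter k = proj₁ (fib-pair k)

fib-iter≡fib : ∀ k → fib-iter k ≡ fib k
fib-iter≡fib k = cong proj₁ (pair-correct k)
  where
  pair-correct : ∀ k → fib-pair k ≡ (fib k , fib (suc k))
  pair-correct zero    = refl
  pair-correct (suc k) = cong fib-step (pair-correct k)

fib-cancel-< : ∀ {i j} → fib i < fib j → i < j
fib-cancel-< {i} {j} fib-i<fib-j with i <? j
... | yes i<j = i<j
... | no  i≮j = ⊥-elim (<⇒≱ fib-i<fib-j (fib-mono (≮⇒≥ i≮j)))

SmallInstance : ℕ → ℕ → ℕ → Set
SmallInstance n d s = 1 ≤ n → 1 ≤ d → n + d ≤ 8 → s ≡ 3 ⊎ s ≡ 4 →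
  v < fib-iter 30 × (∀ {m} → m < 30 → v ≡ fib-iter m → n ≡ 1 × d ≡ 1 × m ≡ 3)
  where
  v = fib-iter n ^ s + fib-iter (n + d) ^ s

small-instance? : ∀ n d s → Dec (SmallInstance n d s)
small-instance? n d s =
  1 ≤? n →-dec 1 ≤? d →-dec n + d ≤? 8 →-dec (s ≟ 3 ⊎-dec s ≟ 4) →-dec
  (v <? fib-iter 30) ×-dec allUpTo? (λ m → v ≟ fib-iter m →-dec (n ≟ 1 ×-dec d ≟ 1 ×-dec m ≟ 3)) 30
  where
  v = fib-iter n ^ s + fib-iter (n + d) ^ s

small-instances : ∀ {n} → n < 9 → ∀ {d} → d < 9 → ∀ {s} → s < 5 → SmallInstance n d s
small-instances = from-yes (allUpTo? (λ n → allUpTo? (λ d → allUpTo? (small-instance? n d) 5) 9) 9)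

s∈3,4⇒s<5 : ∀ {s} → s ≡ 3 ⊎ s ≡ 4 → s < 5
s∈3,4⇒s<5 (inj₁ refl) = m≤m+n 4 1
s∈3,4⇒s<5 (inj₂ refl) = ≤-refl

small-case : ∀ {n d m s} → 1 ≤ n → 1 ≤ d → n + d ≤ 8 → s ≡ 3 ⊎ s ≡ 4 →
  fib n ^ s + fib (n + d) ^ s ≡ fib m → n ≡ 1 × d ≡ 1 × m ≡ 3
small-case {n} {d} {m} {s} 1≤n 1≤d n+d≤8 s∈ eq = proj₂ row m<30 (trans v≡fib-m (sym (fib-iter≡fib m)))
  where
  v = fib-iter n ^ s + fib-iter (n + d) ^ s
  row : v < fib-iter 30 × (∀ {m} → m < 30 → v ≡ fib-iter m → n ≡ 1 × d ≡ 1 × m ≡ 3)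
  row = small-instances (s≤s (m+n≤o⇒m≤o n n+d≤8)) (s≤s (m+n≤o⇒n≤o n n+d≤8)) (s∈3,4⇒s<5 s∈) 1≤n 1≤d n+d≤8 s∈
  v≡fib-m : v ≡ fib m
  v≡fib-m = trans (cong₂ (λ a b → a ^ s + b ^ s) (fib-iter≡fib n) (fib-iter≡fib (n + d))) eq
  m<30 : m < 30
  m<30 = fib-cancel-< (subst₂ _<_ v≡fib-m (fib-iter≡fib 30) (proj₁ row))

proposition4p9 : (d n m s : ℕ) → 1 ≤ d → 1 ≤ n → 1 ≤ m → (s ≡ 3 ⊎ s ≡ 4) →
    fib n ^ s + fib (n + d) ^ s ≡ fib m →
    n ≡ 1 × d ≡ 1 × m ≡ 3
proposition4p9 d n m s 1≤d 1≤n _ s∈ eq with n + d ≤? 8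
... | yes n+d≤8 = small-case 1≤n 1≤d n+d≤8 s∈ eq
... | no  n+d≰8 with m≤n⇒∃[o]m+o≡n (≰⇒> n+d≰8) | s∈
...   | t , 9+t≡n+d | inj₁ refl = ⊥-elim (no-large-cube-solution {m = m} 1≤d (sym 9+t≡n+d) eq)
...   | t , 9+t≡n+d | inj₂ refl = ⊥-elim (no-large-quartic-solution {m = m} 1≤d (sym 9+t≡n+d) eq)
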